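{- Let $p$ be a prime, $q$ a power of $p$, $m\ge1$, $U\in\mathcal A_m^*$, $\sigma:\mathcal A_m\to\mathcal A_m^*$ a $p$-uniform morphism and $\varphi:\mathcal A_m\to\mathbb{F}_q$ a coding. Let $t\geq1$ and $\alpha\in\mathbb{F}_{p^t}$. Then the sequence $\big(P_{\varphi(\sigma^n(U))}(\alpha)\big)_{n\geq0}$ is ultimately periodic.
   Context: $\mathcal A_m=\{0,\dots,m-1\}$; a $p$-uniform morphism maps each letter to a word of length $p$; a coding is a letter-to-letter map extended to words. For a word $W=w_0\cdots w_{r-1}$ over $\mathbb{F}_q$, $P_W(T)=\sum_{j=0}^{r-1}w_{r-1-j}T^j\in\mathbb{F}_q[T]$. Evaluation at $\alpha$ takes place in a common finite extension of $\mathbb{F}_q$ and $\mathbb{F}_{p^t}$. -}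

module Defs where

open import Level using (Level; _⊔_)
open import Algebra.Bundles using (CommutativeRing)
open import Data.Nat as ℕ using (ℕ; zero; suc)
open import Data.Fin using (Fin)
open import Data.List using (List; []; _∷_; reverse; concatMap)
open import Data.List.Membership.Setoid using ()
open import Data.Vec using (Vec; toList)
open import Data.Product using (Σ; ∃; _×_; _,_)
open import Relation.Nullary using (¬_)

Word : ℕ → Set
Word m = List (Fin m)

UniformMorphism : ℕ → ℕ → Set
UniformMorphism m p = Fin m → Vec (Fin m) p

applyMorphism : ∀ {m p} → UniformMorphism m p → Word m → Word m
applyMorphism σ = concatMap (λ a → toList (σ a))

iterateMorphism : ∀ {m p} → UniformMorphism m p → ℕ → Word m → Word m
iterateMorphism σ zero    U = U
iterateMorphism σ (suc n) U = applyMorphism σ (iterateMorphism σ n U)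

module _ {c ℓ} (R : CommutativeRing c ℓ) where
  open CommutativeRing R

  natCast : ℕ → Carrier
  natCast zero    = 0#
  natCast (suc n) = 1# + natCast n

  pow : Carrier → ℕ → Carrier
  pow x zero    = 1#
  pow x (suc n) = x * pow x n

  record IsField : Set (c ⊔ ℓ) where
    field
      1≉0     : ¬ (1# ≈ 0#)
      inverse : ∀ x → ¬ (x ≈ 0#) → Σ Carrier λ y → x * y ≈ 1#

  IsFinite : Set (c ⊔ ℓ)
  IsFinite = Σ (List Carrier) λ xs → ∀ x → Data.List.Membership.Setoid._∈_ setoid x xs

  evalCoeffs : List Carrier → Carrier → Carrier
  evalCoeffs []       α = 0#
  evalCoeffs (c ∷ cs) α = c + α * evalCoeffs cs α

  -- P_W(α) = Σ_{j<r} w_{r-1-j} α^j for W = w_0 ⋯ w_{r-1}: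
  -- the coefficient of T^j is w_{r-1-j}, i.e. the coefficient list is reverse W.
  evalWordPoly : List Carrier → Carrier → Carrier
  evalWordPoly W α = evalCoeffs (reverse W) α

  UltimatelyPeriodic : (ℕ → Carrier) → Set ℓ
  UltimatelyPeriodic s =
    Σ ℕ λ N → Σ ℕ λ T → (0 ℕ.< T) × (∀ n → N ℕ.≤ n → s (n ℕ.+ T) ≈ s n)

-- For a coding g and a p-uniform morphism σ, P_{g(σ(W))}(β) = P_{g′(W)}(β^p) with
-- g′(a) = P_{g(σ(a))}(β): σ(W) is W with every letter replaced by a block of length p, so the
-- blocks are weighted by powers of β^p. Hence P_{φ(σ^n(U))}(α) = P_{g_n(U)}(β_n) along the orbit
-- (β_n , g_n) of (α , φ) under (β , g) ↦ (β^p , g′). This orbit lives in the finite set K × K^m,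
-- so it is ultimately periodic, and so is the sequence read off from it.
module Submission where

open import Defs
open import Level using (Level)
open import Algebra.Bundles using (CommutativeRing)
open import Data.Nat using (ℕ; _≤_; _^_)
open import Data.Nat.Primality using (Prime)
open import Data.Fin using (Fin)
open import Data.List using (map)
open import Data.Product using (Σ; _×_)
open import Relation.Binary.PropositionalEquality using (_≡_)

open import Function using (_∘_)
open import Data.Nat as ℕ using (zero; suc; _∸_; _<_)
import Data.Nat.Properties as ℕ
open import Data.Nat.GeneralisedArithmetic using (iterate)
open import Data.Fin as Fin using (toℕ; combine; funToFin; finToFun)
import Data.Fin.Properties as Fin
open import Data.List as List using (List; []; _∷_; [_]; _++_; reverse; length)
import Data.List.Properties as List
open import Data.List.Relation.Unary.Any as Any using (Any)
import Data.List.Relation.Unary.Any.Properties as Any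
open import Data.Vec as Vec using (toList)
import Data.Vec.Properties as Vec
open import Data.Vec.Functional using (Vector)
import Data.Vec.Functional.Relation.Binary.Equality.Setoid as VectorEq
open import Data.Product using (_,_)
open import Data.Product.Relation.Binary.Pointwise.NonDependent using (×-setoid)
open import Relation.Binary.Bundles using (Setoid)
open import Relation.Binary.Core using (_Preserves_⟶_)
open import Relation.Binary.PropositionalEquality as ≡ using (cong)
import Relation.Binary.Reasoning.Setoid as SetoidReasoning

+-∸-exchange : ∀ n {i j} → i ≤ j → i ≤ n → n ℕ.+ (j ∸ i) ≡ j ℕ.+ (n ∸ i)
+-∸-exchange n {i} {j} i≤j i≤n = begin
  n ℕ.+ (j ∸ i) ≡⟨ ≡.sym (ℕ.+-∸-assoc n i≤j) ⟩
  n ℕ.+ j ∸ i   ≡⟨ cong (_∸ i) (ℕ.+-comm n j) ⟩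
  j ℕ.+ n ∸ i   ≡⟨ ℕ.+-∸-assoc j i≤n ⟩
  j ℕ.+ (n ∸ i) ∎
  where open ≡.≡-Reasoning

iterate-+ : ∀ {a} {A : Set a} (f : A → A) x m n → iterate f x (m ℕ.+ n) ≡ iterate f (iterate f x m) n
iterate-+ f x zero    n = ≡.refl
iterate-+ f x (suc m) n = iterate-+ f (f x) m n

FaithfulEncoding : ∀ {a ℓ} → Setoid a ℓ → ℕ → Set (a Level.⊔ ℓ)
FaithfulEncoding S N = Σ (Carrier → Fin N) λ enc → ∀ {x y} → enc x ≡ enc y → x ≈ y
  where open Setoid S

faithfulEncoding-× : ∀ {a₁ ℓ₁ a₂ ℓ₂} (S₁ : Setoid a₁ ℓ₁) (S₂ : Setoid a₂ ℓ₂) {N₁ N₂} →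
                     FaithfulEncoding S₁ N₁ → FaithfulEncoding S₂ N₂ →
                     FaithfulEncoding (×-setoid S₁ S₂) (N₁ ℕ.* N₂)
faithfulEncoding-× _ _ (enc₁ , faithful₁) (enc₂ , faithful₂) =
  (λ (x , y) → combine (enc₁ x) (enc₂ y)) ,
  λ eq → let (eq₁ , eq₂) = Fin.combine-injective _ _ _ _ eq in faithful₁ eq₁ , faithful₂ eq₂

module _ {a ℓ} (S : Setoid a ℓ) where
  open Setoid S

  enumeration⇒faithfulEncoding : (xs : List Carrier) → (∀ x → Any (x ≈_) xs) →
                                 FaithfulEncoding S (length xs)
  enumeration⇒faithfulEncoding xs mem = code , code-faithful
    where
    code : Carrier → Fin (length xs)
    code x = Any.index (mem x)

    decode-code : ∀ x → x ≈ List.lookup xs (code x)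
    decode-code x = Any.lookup-index (mem x)

    code-faithful : ∀ {x y} → code x ≡ code y → x ≈ y
    code-faithful {x} {y} eq =
      trans (decode-code x) (trans (reflexive (cong (List.lookup xs) eq)) (sym (decode-code y)))

  faithfulEncoding-Vector : ∀ {N} m → FaithfulEncoding S N →
                            FaithfulEncoding (VectorEq.≋-setoid S m) (N ^ m)
  faithfulEncoding-Vector m (enc , enc-faithful) = funToFin ∘ (enc ∘_) , faithful
    where
    faithful : ∀ {v w : Vector Carrier m} → funToFin (enc ∘ v) ≡ funToFin (enc ∘ w) → ∀ i → v i ≈ w i
    faithful {v} {w} eq i = enc-faithful (begin
      enc (v i)                       ≡⟨ ≡.sym (Fin.finToFun-funToFin (enc ∘ v) i) ⟩
      finToFun (funToFin (enc ∘ v)) i ≡⟨ cong (λ k → finToFun k i) eq ⟩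
      finToFun (funToFin (enc ∘ w)) i ≡⟨ Fin.finToFun-funToFin (enc ∘ w) i ⟩
      enc (w i)                       ∎)
      where open ≡.≡-Reasoning

  iterate-cong : ∀ {f} → f Preserves _≈_ ⟶ _≈_ → ∀ n → (λ x → iterate f x n) Preserves _≈_ ⟶ _≈_
  iterate-cong f-cong zero    x≈y = x≈y
  iterate-cong f-cong (suc n) x≈y = iterate-cong f-cong n (f-cong x≈y)

  orbit-ultimatelyPeriodic :
    ∀ {N} → FaithfulEncoding S N → ∀ {f} → f Preserves _≈_ ⟶ _≈_ → ∀ x →
    Σ ℕ λ I → Σ ℕ λ T → 0 < T × (∀ n → I ≤ n → iterate f x (n ℕ.+ T) ≈ iterate f x n)
  orbit-ultimatelyPeriodic {N} (enc , enc-faithful) {f} f-cong x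
    with i , j , i<j , same-code ← Fin.pigeonhole (ℕ.n<1+n N) (λ k → enc (iterate f x (toℕ k)))
    = I , J ∸ I , ℕ.m<n⇒0<n∸m i<j , periodic
    where
    I J : ℕ
    I = toℕ i
    J = toℕ j

    periodic : ∀ n → I ≤ n → iterate f x (n ℕ.+ (J ∸ I)) ≈ iterate f x n
    periodic n I≤n = begin
      iterate f x (n ℕ.+ (J ∸ I))        ≡⟨ cong (iterate f x) (+-∸-exchange n (ℕ.<⇒≤ i<j) I≤n) ⟩
      iterate f x (J ℕ.+ (n ∸ I))        ≡⟨ iterate-+ f x J (n ∸ I) ⟩
      iterate f (iterate f x J) (n ∸ I)  ≈⟨ iterate-cong f-cong (n ∸ I) (sym (enc-faithful same-code)) ⟩
      iterate f (iterate f x I) (n ∸ I)  ≡⟨ ≡.sym (iterate-+ f x I (n ∸ I)) ⟩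
      iterate f x (I ℕ.+ (n ∸ I))        ≡⟨ cong (iterate f x) (ℕ.m+[n∸m]≡n I≤n) ⟩
      iterate f x n                      ∎
      where open SetoidReasoning S

module Evaluation {c ℓ} (K : CommutativeRing c ℓ) where
  open CommutativeRing K
  open SetoidReasoning setoid
  import Algebra.Properties.Semiring.Exp semiring as Exp

  pow≡^ : ∀ x n → pow K x n ≡ x Exp.^ n
  pow≡^ x zero    = ≡.refl
  pow≡^ x (suc n) = cong (x *_) (pow≡^ x n)

  pow-congˡ : ∀ n {x y} → x ≈ y → pow K x n ≈ pow K y n
  pow-congˡ n {x} {y} x≈y = begin
    pow K x n  ≡⟨ pow≡^ x n ⟩
    x Exp.^ n  ≈⟨ Exp.^-congˡ n x≈y ⟩
    y Exp.^ n  ≡⟨ ≡.sym (pow≡^ y n) ⟩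
    pow K y n  ∎

  pow-pow : ∀ x m n → pow K (pow K x m) n ≈ pow K x (n ℕ.* m)
  pow-pow x m n = begin
    pow K (pow K x m) n    ≡⟨ ≡.trans (pow≡^ (pow K x m) n) (cong (Exp._^ n) (pow≡^ x m)) ⟩
    (x Exp.^ m) Exp.^ n    ≈⟨ Exp.^-assocʳ x m n ⟩
    x Exp.^ (m ℕ.* n)      ≡⟨ ≡.trans (cong (x Exp.^_) (ℕ.*-comm m n)) (≡.sym (pow≡^ x (n ℕ.* m))) ⟩
    pow K x (n ℕ.* m)      ∎

  evalCoeffs-++ : ∀ as bs β →
                  evalCoeffs K (as ++ bs) β ≈ evalCoeffs K as β + pow K β (length as) * evalCoeffs K bs β
  evalCoeffs-++ [] bs β = begin
    evalCoeffs K bs β            ≈⟨ sym (+-identityˡ _) ⟩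
    0# + evalCoeffs K bs β       ≈⟨ +-congˡ (sym (*-identityˡ _)) ⟩
    0# + 1# * evalCoeffs K bs β  ∎
  evalCoeffs-++ (a ∷ as) bs β = begin
    a + β * evalCoeffs K (as ++ bs) β                    ≈⟨ +-congˡ (*-congˡ (evalCoeffs-++ as bs β)) ⟩
    a + β * (E as + pow K β (length as) * E bs)          ≈⟨ +-congˡ (distribˡ _ _ _) ⟩
    a + (β * E as + β * (pow K β (length as) * E bs))    ≈⟨ sym (+-assoc _ _ _) ⟩
    (a + β * E as) + β * (pow K β (length as) * E bs)    ≈⟨ +-congˡ (sym (*-assoc _ _ _)) ⟩
    (a + β * E as) + pow K β (suc (length as)) * E bs    ∎
    where
    E : List Carrier → Carrier
    E cs = evalCoeffs K cs β

  evalWord : ∀ {A : Set} → (A → Carrier) → Carrier → List A → Carrier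
  evalWord g β W = evalWordPoly K (map g W) β

  module _ {A : Set} (g : A → Carrier) (β : Carrier) where

    evalWord-++ : ∀ V W → evalWord g β (V ++ W) ≈ evalWord g β W + pow K β (length W) * evalWord g β V
    evalWord-++ V W = begin
      evalCoeffs K (reverse (map g (V ++ W))) β
        ≡⟨ cong (λ cs → evalCoeffs K cs β)
             (≡.trans (cong reverse (List.map-++ g V W)) (List.reverse-++ (map g V) (map g W))) ⟩
      evalCoeffs K (reverse (map g W) ++ reverse (map g V)) β
        ≈⟨ evalCoeffs-++ (reverse (map g W)) _ β ⟩
      evalWord g β W + pow K β (length (reverse (map g W))) * evalWord g β V
        ≡⟨ cong (λ k → evalWord g β W + pow K β k * evalWord g β V)
             (≡.trans (List.length-reverse (map g W)) (List.length-map g W)) ⟩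
      evalWord g β W + pow K β (length W) * evalWord g β V ∎

    evalWord-[_] : ∀ a → evalWord g β [ a ] ≈ g a
    evalWord-[ a ] = trans (+-congˡ (zeroʳ β)) (+-identityʳ (g a))

    evalWord-∷ : ∀ a W → evalWord g β (a ∷ W) ≈ evalWord g β W + pow K β (length W) * g a
    evalWord-∷ a W = trans (evalWord-++ [ a ] W) (+-congˡ (*-congˡ evalWord-[ a ]))

  evalWord-cong : ∀ {A : Set} {g g′ : A → Carrier} {β β′} → (∀ a → g a ≈ g′ a) → β ≈ β′ →
                  ∀ W → evalWord g β W ≈ evalWord g′ β′ W
  evalWord-cong g≈g′ β≈β′ [] = refl
  evalWord-cong {g = g} {g′} {β} {β′} g≈g′ β≈β′ (a ∷ W) = begin
    evalWord g β (a ∷ W)                        ≈⟨ evalWord-∷ g β a W ⟩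
    evalWord g β W + pow K β (length W) * g a
      ≈⟨ +-cong (evalWord-cong g≈g′ β≈β′ W) (*-cong (pow-congˡ (length W) β≈β′) (g≈g′ a)) ⟩
    evalWord g′ β′ W + pow K β′ (length W) * g′ a ≈⟨ sym (evalWord-∷ g′ β′ a W) ⟩
    evalWord g′ β′ (a ∷ W)                      ∎

  length-applyMorphism : ∀ {m p} (σ : UniformMorphism m p) W →
                         length (applyMorphism σ W) ≡ length W ℕ.* p
  length-applyMorphism σ []      = ≡.refl
  length-applyMorphism σ (a ∷ W) = ≡.trans (List.length-++ (toList (σ a)))
    (≡.cong₂ ℕ._+_ (Vec.length-toList (σ a)) (length-applyMorphism σ W))

  evalWord-applyMorphism : ∀ {m p} (σ : UniformMorphism m p) g β W →
    evalWord g β (applyMorphism σ W) ≈ evalWord (λ a → evalWord g β (toList (σ a))) (pow K β p) W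
  evalWord-applyMorphism σ g β [] = refl
  evalWord-applyMorphism {p = p} σ g β (a ∷ W) = begin
    evalWord g β (toList (σ a) ++ applyMorphism σ W)
      ≈⟨ evalWord-++ g β (toList (σ a)) (applyMorphism σ W) ⟩
    evalWord g β (applyMorphism σ W) + pow K β (length (applyMorphism σ W)) * g′ a
      ≈⟨ +-cong (evalWord-applyMorphism σ g β W)
                (*-congʳ (reflexive (cong (pow K β) (length-applyMorphism σ W)))) ⟩
    evalWord g′ (pow K β p) W + pow K β (length W ℕ.* p) * g′ a
      ≈⟨ +-congˡ (*-congʳ (sym (pow-pow β p (length W)))) ⟩
    evalWord g′ (pow K β p) W + pow K (pow K β p) (length W) * g′ a
      ≈⟨ sym (evalWord-∷ g′ (pow K β p) a W) ⟩
    evalWord g′ (pow K β p) (a ∷ W) ∎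
    where
    g′ : Fin _ → Carrier
    g′ a = evalWord g β (toList (σ a))

  State : ℕ → Set c
  State m = Carrier × Vector Carrier m

  stateSetoid : ℕ → Setoid c ℓ
  stateSetoid m = ×-setoid setoid (VectorEq.≋-setoid setoid m)

  _≈ₛ_ : ∀ {m} → State m → State m → Set ℓ
  _≈ₛ_ {m} = Setoid._≈_ (stateSetoid m)

  evalAt : ∀ {m} → State m → Word m → Carrier
  evalAt (β , g) W = evalWord g β W

  evalAt-cong : ∀ {m} W → (λ s → evalAt {m} s W) Preserves _≈ₛ_ ⟶ _≈_
  evalAt-cong W (β≈β′ , g≈g′) = evalWord-cong g≈g′ β≈β′ W

  step : ∀ {m p} → UniformMorphism m p → State m → State m
  step {p = p} σ (β , g) = pow K β p , λ a → evalWord g β (toList (σ a))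

  step-cong : ∀ {m p} (σ : UniformMorphism m p) → step σ Preserves _≈ₛ_ ⟶ _≈ₛ_
  step-cong {p = p} σ (β≈β′ , g≈g′) =
    pow-congˡ p β≈β′ , λ a → evalWord-cong g≈g′ β≈β′ (toList (σ a))

  evalAt-iterateMorphism : ∀ {m p} (σ : UniformMorphism m p) n s U →
                           evalAt s (iterateMorphism σ n U) ≈ evalAt (iterate (step σ) s n) U
  evalAt-iterateMorphism σ zero    s U = refl
  evalAt-iterateMorphism σ (suc n) (β , g) U =
    trans (evalWord-applyMorphism σ g β (iterateMorphism σ n U))
          (evalAt-iterateMorphism σ n (step σ (β , g)) U)

  evalWord-iterateMorphism-ultimatelyPeriodic :
    IsFinite K → ∀ {m p} (σ : UniformMorphism m p) (g : Fin m → Carrier) β U →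
    UltimatelyPeriodic K (λ n → evalWord g β (iterateMorphism σ n U))
  evalWord-iterateMorphism-ultimatelyPeriodic (xs , mem) {m} σ g β U =
    let I , T , 0<T , periodic =
          orbit-ultimatelyPeriodic (stateSetoid m) stateEncoding (step-cong σ) (β , g)
    in I , T , 0<T , λ n I≤n → begin
      evalAt (β , g) (iterateMorphism σ (n ℕ.+ T) U)  ≈⟨ evalAt-iterateMorphism σ (n ℕ.+ T) (β , g) U ⟩
      evalAt (iterate (step σ) (β , g) (n ℕ.+ T)) U  ≈⟨ evalAt-cong U (periodic n I≤n) ⟩
      evalAt (iterate (step σ) (β , g) n) U          ≈⟨ sym (evalAt-iterateMorphism σ n (β , g) U) ⟩
      evalAt (β , g) (iterateMorphism σ n U)         ∎
    where
    elementEncoding : FaithfulEncoding setoid (length xs)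
    elementEncoding = enumeration⇒faithfulEncoding setoid xs mem

    stateEncoding : FaithfulEncoding (stateSetoid m) (length xs ℕ.* length xs ^ m)
    stateEncoding = faithfulEncoding-× setoid (VectorEq.≋-setoid setoid m)
                      elementEncoding (faithfulEncoding-Vector setoid m elementEncoding)

proposition4p15 :
    ∀ {c ℓ} (K : CommutativeRing c ℓ) → IsField K → IsFinite K →
    (p : ℕ) → Prime p → CommutativeRing._≈_ K (natCast K p) (CommutativeRing.0# K) →
    (q : ℕ) → Σ ℕ (λ s → 1 ≤ s × q ≡ p ^ s) →
    (m : ℕ) → 1 ≤ m → (U : Word m) → (σ : UniformMorphism m p) →
    (φ : Fin m → CommutativeRing.Carrier K) →
    (∀ a → CommutativeRing._≈_ K (pow K (φ a) q) (φ a)) →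
    (t : ℕ) → 1 ≤ t → (α : CommutativeRing.Carrier K) →
    CommutativeRing._≈_ K (pow K α (p ^ t)) α →
    UltimatelyPeriodic K (λ n → evalWordPoly K (map φ (iterateMorphism σ n U)) α)
proposition4p15 K _ finite _ _ _ _ _ _ _ U σ φ _ _ _ α _ =
  Evaluation.evalWord-iterateMorphism-ultimatelyPeriodic K finite σ φ α U
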